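{- Let $G=(V,E)$ be a graph with two non-adjacent vertices $v,u$, and let $c,q\in[k]$ with $c\neq q$. Then $S(c,c)$ and $S(q,c)$ are isomorphic, and the map $H(\cdot,q):S(c,c)\to S(q,c)$ is a bijection.
   Context: $[k]=\{1,\dots,k\}$. $\Omega$ is the set of proper $k$-colourings of $G$ and $\Omega(a,b)$ the set of $\sigma\in\Omega$ with $\sigma_v=a,\sigma_u=b$. For $\sigma\in\Omega$ and $q\neq\sigma_v$, the disagreement graph $Q_{\sigma_v,q}$ is the subgraph of $G$ induced by the vertices $x$ for which there is a path $v=w_0,\dots,w_t=x$ in $G$ with $\sigma_{w_j}\in\{\sigma_v,q\}$ for all $j$. $H(\sigma,q)$ is obtained from $\sigma$ by recolouring each vertex of $Q_{\sigma_v,q}$ coloured $\sigma_v$ with $q$ and each vertex of $Q_{\sigma_v,q}$ coloured $q$ with $\sigma_v$. $S(c,c)$ is the set of $\sigma\in\Omega(c,c)$ such that $Q_{\sigma_v,q}$ does not contain $u$; $S(q,c)$ is the set of $\sigma\in\Omega(q,c)$ such that $Q_{\sigma_v,c}$ does not contain $u$. Two sets are isomorphic if there is a bijection between them. -}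

module Defs where

open import Data.Nat using (ℕ)
open import Data.Fin using (Fin; _≟_)
open import Data.Product using (Σ; _×_; _,_)
open import Data.Sum using (_⊎_)
open import Relation.Nullary using (¬_; Dec; yes; no)
open import Relation.Binary.PropositionalEquality using (_≡_; _≢_)

record Graph (n : ℕ) : Set₁ where
  field
    E     : Fin n → Fin n → Set
    sym   : ∀ {x y} → E x y → E y x
    irrefl : ∀ {x} → ¬ E x x
open Graph public

Colouring : ℕ → ℕ → Set
Colouring n k = Fin n → Fin k

Proper : ∀ {n k} → Graph n → Colouring n k → Set
Proper G σ = ∀ x y → E G x y → σ x ≢ σ y

InΩ : ∀ {n k} → Graph n → (v u : Fin n) → Fin k → Fin k → Colouring n k → Set
InΩ G v u a b σ = Proper G σ × σ v ≡ a × σ u ≡ b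

-- x is a vertex of the disagreement graph Q_{σ_v,q}: there is a path
-- v = w₀, …, w_t = x in G all of whose vertices have colour in {σ_v, q}.
data InQ {n k} (G : Graph n) (v : Fin n) (σ : Colouring n k) (q : Fin k)
       : Fin n → Set where
  start : InQ G v σ q v
  step  : ∀ {w x} → InQ G v σ q w → E G w x → (σ x ≡ σ v ⊎ σ x ≡ q)
        → InQ G v σ q x

-- A decision procedure for membership in disagreement graphs
-- (needed to define the recolouring H computably).
QDecider : ∀ {n} → (k : ℕ) → Graph n → Fin n → Set
QDecider {n} k G v = (σ : Colouring n k) (q : Fin k) (x : Fin n) → Dec (InQ G v σ q x)

swapCol : ∀ {k} → Fin k → Fin k → Fin k → Fin k
swapCol a b y with y ≟ a
... | yes _ = b
... | no _ with y ≟ b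
...   | yes _ = a
...   | no _ = y

H : ∀ {n k} {G : Graph n} {v : Fin n} → QDecider k G v → Colouring n k → Fin k → Colouring n k
H {v = v} dec σ q x with dec σ q x
... | yes _ = swapCol (σ v) q (σ x)
... | no _ = σ x

-- S(a,b) w.r.t. swap colour r: σ ∈ Ω(a,b) and u ∉ Q_{σ_v,r}.
-- S(c,c) of the paper is  InS G v u c c q ,  S(q,c) is  InS G v u q c c .
InS : ∀ {n k} → Graph n → (v u : Fin n) → (a b r : Fin k) → Colouring n k → Set
InS G v u a b r σ = InΩ G v u a b σ × ¬ InQ G v σ r u

-- Recolouring by H is an involution: the disagreement graph of H(σ,q) for the
-- swapped colour pair (q, σ_v) is the same vertex set as that of σ for (σ_v, q),
-- so applying H(·, σ_v) swaps the colours back. H preserves properness, since a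
-- neighbour of Q outside Q has a colour outside {σ_v, q} and keeps it; it fixes
-- every vertex outside Q (in particular u) and recolours v with q. Hence H(·,q)
-- maps S(c,c) into S(q,c), H(·,c) maps S(q,c) into S(c,c), and they are mutually
-- inverse.
module Submission where

open import Defs hiding (sym)
open import Data.Nat using (ℕ)
open import Data.Fin using (Fin; _≟_)
open import Data.Product using (Σ; _×_; _,_)
open import Data.Sum using (_⊎_; inj₁; inj₂; swap)
open import Data.Empty using (⊥-elim)
open import Relation.Nullary using (¬_; Dec; yes; no)
open import Relation.Binary.PropositionalEquality
  using (_≡_; _≢_; _≗_; refl; sym; trans; cong; cong₂; module ≡-Reasoning)

module _ {k : ℕ} where

  swapCol-≡ˡ : (a b : Fin k) → swapCol a b a ≡ b
  swapCol-≡ˡ a b with a ≟ a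
  ... | yes _ = refl
  ... | no a≢a = ⊥-elim (a≢a refl)

  swapCol-≡ʳ : (a b : Fin k) → swapCol a b b ≡ a
  swapCol-≡ʳ a b with b ≟ a
  ... | yes b≡a = b≡a
  ... | no _ with b ≟ b
  ...   | yes _ = refl
  ...   | no b≢b = ⊥-elim (b≢b refl)

  swapCol-fixes : {a b y : Fin k} → y ≢ a → y ≢ b → swapCol a b y ≡ y
  swapCol-fixes {a} {b} {y} y≢a y≢b with y ≟ a
  ... | yes y≡a = ⊥-elim (y≢a y≡a)
  ... | no _ with y ≟ b
  ...   | yes y≡b = ⊥-elim (y≢b y≡b)
  ...   | no _ = refl

  swapCol-involutive : (a b y : Fin k) → swapCol a b (swapCol a b y) ≡ y
  swapCol-involutive a b y with y ≟ a
  ... | yes y≡a = trans (swapCol-≡ʳ a b) (sym y≡a)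
  ... | no y≢a with y ≟ b
  ...   | yes y≡b = trans (swapCol-≡ˡ a b) (sym y≡b)
  ...   | no y≢b = swapCol-fixes y≢a y≢b

  swapCol-comm : (a b y : Fin k) → swapCol a b y ≡ swapCol b a y
  swapCol-comm a b y = by-cases (y ≟ a) (y ≟ b)
    where
      by-cases : Dec (y ≡ a) → Dec (y ≡ b) → swapCol a b y ≡ swapCol b a y
      by-cases (yes refl) _ = trans (swapCol-≡ˡ y b) (sym (swapCol-≡ʳ b y))
      by-cases _ (yes refl) = trans (swapCol-≡ʳ a y) (sym (swapCol-≡ˡ y a))
      by-cases (no y≢a) (no y≢b) = trans (swapCol-fixes y≢a y≢b) (sym (swapCol-fixes y≢b y≢a))

  swapCol-injective : (a b : Fin k) {y z : Fin k} → swapCol a b y ≡ swapCol a b z → y ≡ z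
  swapCol-injective a b {y} {z} eq = begin
    y                                ≡⟨ sym (swapCol-involutive a b y) ⟩
    swapCol a b (swapCol a b y)      ≡⟨ cong (swapCol a b) eq ⟩
    swapCol a b (swapCol a b z)      ≡⟨ swapCol-involutive a b z ⟩
    z                                ∎
    where open ≡-Reasoning

  swapCol-pair : (a b : Fin k) {y : Fin k} → y ≡ a ⊎ y ≡ b → swapCol a b y ≡ b ⊎ swapCol a b y ≡ a
  swapCol-pair a b (inj₁ refl) = inj₁ (swapCol-≡ˡ a b)
  swapCol-pair a b (inj₂ refl) = inj₂ (swapCol-≡ʳ a b)

module Recolouring {n k : ℕ} (G : Graph n) (v : Fin n) (dec : QDecider k G v) where

  variable
    σ τ : Colouring n k
    a r : Fin k
    x y : Fin n

  InQ-colour : InQ G v σ r x → σ x ≡ σ v ⊎ σ x ≡ r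
  InQ-colour start = inj₁ refl
  InQ-colour (step _ _ c) = c

  InQ-resp-≗ : σ ≗ τ → InQ G v σ r x → InQ G v τ r x
  InQ-resp-≗ σ≗τ start = start
  InQ-resp-≗ {σ} {τ} σ≗τ (step {x = x} p e (inj₁ c)) =
    step (InQ-resp-≗ σ≗τ p) e (inj₁ (trans (sym (σ≗τ x)) (trans c (σ≗τ v))))
  InQ-resp-≗ σ≗τ (step {x = x} p e (inj₂ c)) =
    step (InQ-resp-≗ σ≗τ p) e (inj₂ (trans (sym (σ≗τ x)) c))

  H-inside : InQ G v σ r x → H dec σ r x ≡ swapCol (σ v) r (σ x)
  H-inside {σ} {r} {x} x∈Q with dec σ r x
  ... | yes _ = refl
  ... | no x∉Q = ⊥-elim (x∉Q x∈Q)

  H-outside : ¬ InQ G v σ r x → H dec σ r x ≡ σ x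
  H-outside {σ} {r} {x} x∉Q with dec σ r x
  ... | yes x∈Q = ⊥-elim (x∉Q x∈Q)
  ... | no _ = refl

  -- Needed because dec may decide extensionally equal colourings differently.
  H-resp-≗ : σ ≗ τ → H dec σ r ≗ H dec τ r
  H-resp-≗ {σ} {τ} {r} σ≗τ x with dec σ r x
  ... | yes x∈Q = sym (trans (H-inside (InQ-resp-≗ σ≗τ x∈Q))
                             (cong₂ (λ c y → swapCol c r y) (sym (σ≗τ v)) (sym (σ≗τ x))))
  ... | no x∉Q = sym (trans (H-outside (λ p → x∉Q (InQ-resp-≗ (λ y → sym (σ≗τ y)) p)))
                            (sym (σ≗τ x)))

  H-at-v : H dec σ r v ≡ r
  H-at-v {σ} {r} = trans (H-inside start) (swapCol-≡ˡ (σ v) r)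

  H-colour-inside : InQ G v σ r x → H dec σ r x ≡ H dec σ r v ⊎ H dec σ r x ≡ σ v
  H-colour-inside {σ} {r} {x} x∈Q with swapCol-pair (σ v) r (InQ-colour x∈Q)
  ... | inj₁ c = inj₁ (trans (H-inside x∈Q) (trans c (sym H-at-v)))
  ... | inj₂ c = inj₂ (trans (H-inside x∈Q) c)

  InQ⇒InQ-H : InQ G v σ r x → InQ G v (H dec σ r) (σ v) x
  InQ⇒InQ-H start = start
  InQ⇒InQ-H (step p e c) = step (InQ⇒InQ-H p) e (H-colour-inside (step p e c))

  InQ-H⇒InQ : InQ G v (H dec σ r) (σ v) x → InQ G v σ r x
  InQ-H⇒InQ start = start
  InQ-H⇒InQ {σ} {r} (step {x = x} p e c) with dec σ r x
  ... | yes x∈Q = x∈Q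
  ... | no x∉Q = step (InQ-H⇒InQ p) e (swap (colour c))
    where
      colour : σ x ≡ H dec σ r v ⊎ σ x ≡ σ v → σ x ≡ r ⊎ σ x ≡ σ v
      colour (inj₁ c) = inj₁ (trans c H-at-v)
      colour (inj₂ c) = inj₂ c

  H-involutive : σ v ≡ a → H dec (H dec σ r) a ≗ σ
  H-involutive {σ} {r = r} refl x with dec σ r x
  ... | yes x∈Q = begin
      H dec (H dec σ r) (σ v) x                    ≡⟨ H-inside (InQ⇒InQ-H x∈Q) ⟩
      swapCol (H dec σ r v) (σ v) (H dec σ r x)    ≡⟨ cong₂ (λ c y → swapCol c (σ v) y) H-at-v (H-inside x∈Q) ⟩
      swapCol r (σ v) (swapCol (σ v) r (σ x))      ≡⟨ swapCol-comm r (σ v) (swapCol (σ v) r (σ x)) ⟩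
      swapCol (σ v) r (swapCol (σ v) r (σ x))      ≡⟨ swapCol-involutive (σ v) r (σ x) ⟩
      σ x                                          ∎
    where open ≡-Reasoning
  ... | no x∉Q = trans (H-outside (λ p → x∉Q (InQ-H⇒InQ p))) (H-outside x∉Q)

  H-injective : σ v ≡ τ v → H dec σ r ≗ H dec τ r → σ ≗ τ
  H-injective {σ} {τ} {r} σv≡τv Hσ≗Hτ x = begin
    σ x                          ≡⟨ sym (H-involutive σv≡τv x) ⟩
    H dec (H dec σ r) (τ v) x    ≡⟨ H-resp-≗ Hσ≗Hτ x ⟩
    H dec (H dec τ r) (τ v) x    ≡⟨ H-involutive refl x ⟩
    τ x                          ∎
    where open ≡-Reasoning

  InQ-step-swapped : InQ G v σ r x → E G x y → swapCol (σ v) r (σ x) ≡ σ y → InQ G v σ r y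
  InQ-step-swapped {σ} {r} x∈Q e eq with swapCol-pair (σ v) r (InQ-colour x∈Q)
  ... | inj₁ c = step x∈Q e (inj₂ (trans (sym eq) c))
  ... | inj₂ c = step x∈Q e (inj₁ (trans (sym eq) c))

  H-proper : Proper G σ → Proper G (H dec σ r)
  H-proper {σ} {r} proper x y e with dec σ r x | dec σ r y
  ... | yes _   | yes _   = λ eq → proper x y e (swapCol-injective (σ v) r eq)
  ... | yes x∈Q | no y∉Q = λ eq → y∉Q (InQ-step-swapped x∈Q e eq)
  ... | no x∉Q  | yes y∈Q = λ eq → x∉Q (InQ-step-swapped y∈Q (Graph.sym G e) (sym eq))
  ... | no _    | no _    = proper x y e

  H-maps-S : {u : Fin n} {b : Fin k} → InS G v u a b r σ → InS G v u r b a (H dec σ r)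
  H-maps-S ((proper , refl , σu≡b) , u∉Q) =
    (H-proper proper , H-at-v , trans (H-outside u∉Q) σu≡b) , λ p → u∉Q (InQ-H⇒InQ p)

lemma2 : ∀ {n k : ℕ} (G : Graph n) (v u : Fin n) → v ≢ u → ¬ E G v u
    → (c q : Fin k) → c ≢ q → (dec : QDecider k G v)
    → (∀ σ → InS G v u c c q σ → InS G v u q c c (H dec σ q))
    × (∀ σ τ → InS G v u c c q σ → InS G v u c c q τ → H dec σ q ≗ H dec τ q → σ ≗ τ)
    × (∀ τ → InS G v u q c c τ → Σ (Colouring n k) (λ σ → InS G v u c c q σ × H dec σ q ≗ τ))
lemma2 G v u _ _ c q _ dec =
    (λ _ → H-maps-S)
  , (λ _ _ ((_ , σv≡c , _) , _) ((_ , τv≡c , _) , _) → H-injective (trans σv≡c (sym τv≡c)))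
  , λ τ τ∈S@((_ , τv≡q , _) , _) → H dec τ c , H-maps-S τ∈S , H-involutive τv≡q
  where open Recolouring G v dec
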